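{- Let $G$ be a graph with $|V(G)| \in \{8, \dots, 11\}$ and $\delta(G) \ge 6$, and let $v_1, \dots, v_6 \in V(G)$ be distinct vertices. If $v_1 v_2 \notin E(G)$, then there exists a component $C$ of $G - \{v_1, \dots, v_6\}$ such that either $\{v_1, v_2\} \subseteq N_G(C)$ or $\{v_3, v_4, v_5, v_6\} \subseteq N_G(C)$.
   Context: All graphs are finite and simple. For a subgraph $C$ of $G$, $N_G(C)$ denotes the set of vertices of $V(G) \setminus V(C)$ having a neighbor in $V(C)$. -}

module Defs where

open import Data.Nat using (ℕ; _≤_)
open import Data.Fin using (Fin)
open import Data.Bool using (Bool; true; false)
open import Data.Fin.Subset using (Subset; ∣_∣)
open import Data.Vec using (tabulate)
open import Data.Product using (Σ; ∃; _×_)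
open import Relation.Binary.PropositionalEquality using (_≡_)
open import Relation.Nullary using (¬_)

record Graph (n : ℕ) : Set where
  field
    adj   : Fin n → Fin n → Bool
    sym   : ∀ u v → adj u v ≡ adj v u
    irrefl : ∀ v → adj v v ≡ false
open Graph public

_~[_]_ : ∀ {n} → Fin n → Graph n → Fin n → Set
u ~[ G ] v = adj G u v ≡ true

degree : ∀ {n} → Graph n → Fin n → ℕ
degree G v = ∣ tabulate (adj G v) ∣

MinDegree≥ : ∀ {n} → Graph n → ℕ → Set
MinDegree≥ G k = ∀ v → k ≤ degree G v

-- Reach G S u w : there is a walk from u to w in G all of whose vertices
-- after u lie outside S (with u ∉ S this is a walk in G - S).
data Reach {n} (G : Graph n) (S : Fin n → Set) : Fin n → Fin n → Set where
  here : ∀ {u} → Reach G S u u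
  step : ∀ {u v w} → u ~[ G ] v → ¬ S v → Reach G S v w → Reach G S u w

-- The component of G - S containing c (for c ∉ S) has vertex set
-- { x | Reach G S c x }.
InComp : ∀ {n} → Graph n → (Fin n → Set) → Fin n → Fin n → Set
InComp G S c x = Reach G S c x

InNbhdComp : ∀ {n} → Graph n → (Fin n → Set) → Fin n → Fin n → Set
InNbhdComp G S c x = ¬ InComp G S c x × ∃ λ y → InComp G S c y × (y ~[ G ] x)

-- Let S = {v₁,…,v₆}. Since v₁v₂ ∉ E(G), each of v₁, v₂ has at most four neighbours in
-- S and hence a neighbour a, resp. b, outside S. A vertex outside S with at most one
-- neighbour outside S has at least five neighbours in S, so it misses at most one vᵢ,
-- and its component sees v₁ and v₂ or all of v₃,…,v₆. Otherwise a and b each have two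
-- further neighbours outside S. If a and b lie in one component, that component sees
-- v₁ and v₂; if not, the two stars centred at a and b are disjoint, and together with
-- S they give twelve distinct vertices, which is impossible when |V(G)| ≤ 11.
module Submission where

open import Defs renaming (sym to adj-sym)
open import Data.Bool using (Bool; true; false)
open import Data.Bool.Properties using () renaming (_≟_ to _≟ᵇ_)
open import Data.Empty using (⊥-elim)
open import Data.Fin using (Fin; zero; suc; #_; punchIn; punchOut; splitAt; join)
open import Data.Fin.Properties using (any?; injective⇒≤; join-splitAt; punchIn-punchOut; punchOut-injective)
  renaming (_≟_ to _≟ᶠ_)
open import Data.Fin.Subset using (∣_∣)
open import Data.List using (List; []; _∷_; length)
open import Data.List.Membership.Propositional using (_∈_)
open import Data.List.Membership.Propositional.Properties using (∈-tabulate⁺)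
open import Data.List.Properties using (length-tabulate)
open import Data.List.Relation.Unary.Any using (here; there)
open import Data.Nat as ℕ using (ℕ; _≤_; _<_; _+_; z≤n; s≤s)
open import Data.Nat.Properties using (≤-trans; ≤-reflexive; m≤n⇒m≤1+n; ≤⇒≯)
open import Data.Product using (Σ; ∃; ∃₂; _×_; _,_; proj₁; proj₂)
open import Data.Sum using (_⊎_; inj₁; inj₂; [_,_])
open import Data.Vec using (tabulate)
import Data.List as List
import Data.Vec.Functional as Vector
open import Data.Vec.Functional.Relation.Unary.All using (All)
open import Data.Vec.Functional.Relation.Unary.All.Properties using (++⁺)
open import Function.Definitions using (Injective)
open import Relation.Binary.PropositionalEquality using (_≡_; _≢_; refl; sym; trans; cong; subst)
open import Relation.Nullary using (¬_; Dec; yes; no)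
open import Relation.Nullary.Decidable using (_×-dec_; ¬?)
open import Relation.Unary using (Pred; Decidable)

predecessors : ∀ {m} → List (Fin (1 + m)) → List (Fin m)
predecessors []           = []
predecessors (zero  ∷ xs) = predecessors xs
predecessors (suc y ∷ xs) = y ∷ predecessors xs

length-predecessors-≤ : ∀ {m} (xs : List (Fin (1 + m))) → length (predecessors xs) ≤ length xs
length-predecessors-≤ []           = z≤n
length-predecessors-≤ (zero  ∷ xs) = m≤n⇒m≤1+n (length-predecessors-≤ xs)
length-predecessors-≤ (suc y ∷ xs) = s≤s (length-predecessors-≤ xs)

length-predecessors-< : ∀ {m} (xs : List (Fin (1 + m))) → zero ∈ xs → length (predecessors xs) < length xs
length-predecessors-< (zero  ∷ xs) _          = s≤s (length-predecessors-≤ xs)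
length-predecessors-< (suc y ∷ xs) (there z∈) = s≤s (length-predecessors-< xs z∈)

∈-predecessors⁺ : ∀ {m} {y : Fin m} (xs : List (Fin (1 + m))) → suc y ∈ xs → y ∈ predecessors xs
∈-predecessors⁺ (zero  ∷ xs) (there y∈) = ∈-predecessors⁺ xs y∈
∈-predecessors⁺ (suc y ∷ xs) (here refl) = here refl
∈-predecessors⁺ (suc _ ∷ xs) (there y∈) = there (∈-predecessors⁺ xs y∈)

∣tabulate∣≤length : ∀ {n} (f : Fin n → Bool) (xs : List (Fin n)) →
                    (∀ y → f y ≡ true → y ∈ xs) → ∣ tabulate f ∣ ≤ length xs
∣tabulate∣≤length {ℕ.zero} f xs covers = z≤n
∣tabulate∣≤length {ℕ.suc n} f xs covers
  with f zero in f₀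
     | ∣tabulate∣≤length (λ y → f (suc y)) (predecessors xs) (λ y fy → ∈-predecessors⁺ xs (covers (suc y) fy))
... | true  | tail-bound = ≤-trans (s≤s tail-bound) (length-predecessors-< xs (covers zero f₀))
... | false | tail-bound = ≤-trans tail-bound (length-predecessors-≤ xs)

punchIn²-punchOut : ∀ {m} {p q i : Fin (2 + m)} (p≢q : p ≢ q) → p ≢ i → q ≢ i →
                    ∃ λ j → punchIn p (punchIn (punchOut p≢q) j) ≡ i
punchIn²-punchOut {p = p} {q} {i} p≢q p≢i q≢i =
  punchOut q′≢i′ , trans (cong (punchIn p) (punchIn-punchOut q′≢i′)) (punchIn-punchOut p≢i)
  where
  q′≢i′ : punchOut p≢q ≢ punchOut p≢i
  q′≢i′ e = q≢i (punchOut-injective p≢q p≢i e)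

module _ {a} {A : Set a} where

  injective-∷ : ∀ {k} {x : A} {f : Vector.Vector A k} →
                (∀ i → f i ≢ x) → Injective _≡_ _≡_ f → Injective _≡_ _≡_ (x Vector.∷ f)
  injective-∷ fresh inj {zero}  {zero}  _ = refl
  injective-∷ fresh inj {zero}  {suc j} e = ⊥-elim (fresh j (sym e))
  injective-∷ fresh inj {suc i} {zero}  e = ⊥-elim (fresh i e)
  injective-∷ fresh inj {suc i} {suc j} e = cong suc (inj e)

  injective-++ : ∀ {k l} {f : Vector.Vector A k} {g : Vector.Vector A l} →
                 Injective _≡_ _≡_ f → Injective _≡_ _≡_ g → (∀ i j → f i ≢ g j) →
                 Injective _≡_ _≡_ (f Vector.++ g)
  injective-++ {k} {l} {f} {g} f-inj g-inj disjoint {i} {j} e =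
    splitAt-injective ([,]-injective (splitAt k i) (splitAt k j) e)
    where
    splitAt-injective : splitAt k i ≡ splitAt k j → i ≡ j
    splitAt-injective e′ =
      trans (sym (join-splitAt k l i)) (trans (cong (join k l) e′) (join-splitAt k l j))

    [,]-injective : ∀ s t → [ f , g ] s ≡ [ f , g ] t → s ≡ t
    [,]-injective (inj₁ s) (inj₁ t) e′ = cong inj₁ (f-inj e′)
    [,]-injective (inj₁ s) (inj₂ t) e′ = ⊥-elim (disjoint s t e′)
    [,]-injective (inj₂ s) (inj₁ t) e′ = ⊥-elim (disjoint t s (sym e′))
    [,]-injective (inj₂ s) (inj₂ t) e′ = cong inj₂ (g-inj e′)

AtMostOne : ∀ {n ℓ} → Pred (Fin n) ℓ → Set ℓ
AtMostOne P = ∃ λ y₀ → ∀ y → P y → y ≡ y₀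

TwoDistinct : ∀ {n ℓ} → Pred (Fin n) ℓ → Set ℓ
TwoDistinct P = ∃₂ λ y z → P y × P z × y ≢ z

-- The vertex argument is only the witness of AtMostOne when P is empty.
atMostOne⊎twoDistinct : ∀ {n ℓ} {P : Pred (Fin n) ℓ} → Decidable P → Fin n →
                        AtMostOne P ⊎ TwoDistinct P
atMostOne⊎twoDistinct {P = P} P? default with any? P?
... | no ∄y = inj₁ (default , λ y Py → ⊥-elim (∄y (y , Py)))
... | yes (y , Py) with any? (λ z → P? z ×-dec ¬? (y ≟ᶠ z))
...   | yes (z , Pz , y≢z) = inj₂ (y , z , Py , Pz , y≢z)
...   | no ∄z = inj₁ (y , only-y)
  where
  only-y : ∀ z → P z → z ≡ y
  only-y z Pz with y ≟ᶠ z
  ... | yes y≡z = sym y≡z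
  ... | no y≢z  = ⊥-elim (∄z (z , Pz , y≢z))

Image : ∀ {k n} → (Fin k → Fin n) → Fin n → Set
Image v x = ∃ λ i → v i ≡ x

module _ {n} (G : Graph n) where

  _~?_ : ∀ x y → Dec (x ~[ G ] y)
  x ~? y = adj G x y ≟ᵇ true

  ~-sym : ∀ {x y} → x ~[ G ] y → y ~[ G ] x
  ~-sym {x} {y} x~y = trans (adj-sym G y x) x~y

  ~⇒≢ : ∀ {x y} → x ~[ G ] y → x ≢ y
  ~⇒≢ {x} x~x refl with () ← trans (sym x~x) (irrefl G x)

  module _ (S : Fin n → Set) where

    OutsideNeighbour : Fin n → Fin n → Set
    OutsideNeighbour x y = ¬ S y × x ~[ G ] y

    Reach-trans : ∀ {u w z} → Reach G S u w → Reach G S w z → Reach G S u z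
    Reach-trans here           r′ = r′
    Reach-trans (step e ¬Sv r) r′ = step e ¬Sv (Reach-trans r r′)

    Reach-avoids : ∀ {c x} → ¬ S c → Reach G S c x → ¬ S x
    Reach-avoids ¬Sc here           = ¬Sc
    Reach-avoids ¬Sc (step _ ¬Sv r) = Reach-avoids ¬Sv r

    inNbhdComp : ∀ {c y x} → ¬ S c → S x → InComp G S c y → y ~[ G ] x → InNbhdComp G S c x
    inNbhdComp ¬Sc Sx c⇝y y~x = (λ c⇝x → Reach-avoids ¬Sc c⇝x Sx) , _ , c⇝y , y~x

    module Star {c y z} (¬Sc : ¬ S c) (out-y : OutsideNeighbour c y) (out-z : OutsideNeighbour c z)
                (y≢z : y ≢ z) where

      vertices : Fin 3 → Fin n
      vertices = c Vector.∷ y Vector.∷ z Vector.∷ Vector.[]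

      vertices-injective : Injective _≡_ _≡_ vertices
      vertices-injective =
        injective-∷ (λ { zero → ~⇒≢ (~-sym (out-y .proj₂)) ; (suc zero) → ~⇒≢ (~-sym (out-z .proj₂))
                       ; (suc (suc ())) })
          (injective-∷ (λ { zero z≡y → y≢z (sym z≡y) ; (suc ()) })
            (injective-∷ (λ ()) λ { {()} }))

      vertices-outside : All (λ x → ¬ S x) vertices
      vertices-outside zero             = ¬Sc
      vertices-outside (suc zero)       = out-y .proj₁
      vertices-outside (suc (suc zero)) = out-z .proj₁

      centre-reaches : ∀ i → Reach G S c (vertices i)
      centre-reaches zero             = here
      centre-reaches (suc zero)       = step (out-y .proj₂) (out-y .proj₁) here
      centre-reaches (suc (suc zero)) = step (out-z .proj₂) (out-z .proj₁) here

      reaches-centre : ∀ i → Reach G S (vertices i) c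
      reaches-centre zero             = here
      reaches-centre (suc zero)       = step (~-sym (out-y .proj₂)) ¬Sc here
      reaches-centre (suc (suc zero)) = step (~-sym (out-z .proj₂)) ¬Sc here

module Separator {n m} (G : Graph n) (v : Fin (2 + m) → Fin n) where

  S : Fin n → Set
  S = Image v

  S? : Decidable S
  S? x = any? (λ i → v i ≟ᶠ x)

  outside? : ∀ x → Decidable (OutsideNeighbour G S x)
  outside? x y = ¬? (S? y) ×-dec (_~?_ G x y)

  degree-≤ : ∀ {x p q} → p ≢ q → ¬ x ~[ G ] v p → ¬ x ~[ G ] v q →
             AtMostOne (OutsideNeighbour G S x) → degree G x ≤ 1 + m
  degree-≤ {x} {p} {q} p≢q x≁vp x≁vq (y₀ , sparse) =
    ≤-trans (∣tabulate∣≤length (adj G x) (y₀ ∷ List.tabulate w) covers)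
            (≤-reflexive (cong ℕ.suc (length-tabulate w)))
    where
    w : Fin m → Fin n
    w j = v (punchIn p (punchIn (punchOut p≢q) j))

    covers : ∀ y → x ~[ G ] y → y ∈ y₀ ∷ List.tabulate w
    covers y x~y with S? y
    ... | no ¬Sy = here (sparse y (¬Sy , x~y))
    ... | yes (i , refl) with punchIn²-punchOut {i = i} p≢q (λ { refl → x≁vp x~y }) (λ { refl → x≁vq x~y })
    ...   | j , refl = there (∈-tabulate⁺ j)

  adjacent-unless : MinDegree≥ G (2 + m) → ∀ {x p q} → AtMostOne (OutsideNeighbour G S x) → p ≢ q →
                    ¬ x ~[ G ] v p → x ~[ G ] v q
  adjacent-unless md {x} {p} {q} sparse p≢q x≁vp with _~?_ G x (v q)
  ... | yes x~vq = x~vq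
  ... | no x≁vq  = ⊥-elim (≤⇒≯ (degree-≤ p≢q x≁vp x≁vq sparse) (md x))

  outside-neighbour : MinDegree≥ G (2 + m) → ∀ {p q} → p ≢ q → ¬ v p ~[ G ] v q → ∃ (OutsideNeighbour G S (v p))
  outside-neighbour md {p} p≢q vp≁vq with atMostOne⊎twoDistinct (outside? (v p)) (v p)
  ... | inj₁ sparse                = ⊥-elim (vp≁vq (adjacent-unless md sparse p≢q (λ vp~vp → ~⇒≢ G vp~vp refl)))
  ... | inj₂ (y , _ , out-y , _) = y , out-y

open Separator using (outside?; outside-neighbour)

module _ {n} (G : Graph n) (v : Fin 6 → Fin n) where

  open Separator {m = 4} G v

  N : Fin n → Fin n → Set
  N = InNbhdComp G S

  Conclusion : Fin n → Set
  Conclusion c = ¬ S c × ((N c (v (# 0)) × N c (v (# 1)))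
                          ⊎ (N c (v (# 2)) × N c (v (# 3)) × N c (v (# 4)) × N c (v (# 5))))

  neighbour-in-N : ∀ {c k} → ¬ S c → c ~[ G ] v k → N c (v k)
  neighbour-in-N ¬Sc c~vk = inNbhdComp G S ¬Sc (_ , refl) here c~vk

  sees-v₂…v₅ : ∀ {c} → ¬ S c → (∀ (k : Fin 4) → c ~[ G ] v (suc (suc k))) →
               N c (v (# 2)) × N c (v (# 3)) × N c (v (# 4)) × N c (v (# 5))
  sees-v₂…v₅ ¬Sc adj-all = neighbour-in-N ¬Sc (adj-all (# 0)) , neighbour-in-N ¬Sc (adj-all (# 1))
                         , neighbour-in-N ¬Sc (adj-all (# 2)) , neighbour-in-N ¬Sc (adj-all (# 3))

  sparse⇒conclusion : MinDegree≥ G 6 → ∀ {c} → ¬ S c → AtMostOne (OutsideNeighbour G S c) → Conclusion c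
  sparse⇒conclusion md {c} ¬Sc sparse with _~?_ G c (v (# 0)) | _~?_ G c (v (# 1))
  ... | no c≁v₀  | _        = ¬Sc , inj₂ (sees-v₂…v₅ ¬Sc λ _ → adjacent-unless md sparse (λ ()) c≁v₀)
  ... | yes _    | no c≁v₁  = ¬Sc , inj₂ (sees-v₂…v₅ ¬Sc λ _ → adjacent-unless md sparse (λ ()) c≁v₁)
  ... | yes c~v₀ | yes c~v₁ = ¬Sc , inj₁ (neighbour-in-N ¬Sc c~v₀ , neighbour-in-N ¬Sc c~v₁)

  module _ (n≤11 : n ≤ 11) (v-injective : Injective _≡_ _≡_ v)
           {a a₁ a₂ b b₁ b₂} (¬Sa : ¬ S a) (out-a₁ : OutsideNeighbour G S a a₁)
           (out-a₂ : OutsideNeighbour G S a a₂) (a₁≢a₂ : a₁ ≢ a₂)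
           (¬Sb : ¬ S b) (out-b₁ : OutsideNeighbour G S b b₁)
           (out-b₂ : OutsideNeighbour G S b b₂) (b₁≢b₂ : b₁ ≢ b₂) where

    private
      module A = Star G S ¬Sa out-a₁ out-a₂ a₁≢a₂
      module B = Star G S ¬Sb out-b₁ out-b₂ b₁≢b₂

    dense⇒conclusion : a ~[ G ] v (# 0) → b ~[ G ] v (# 1) → Conclusion a
    dense⇒conclusion a~v₀ b~v₁ with any? (λ i → any? (λ j → A.vertices i ≟ᶠ B.vertices j))
    ... | yes (i , j , e) = ¬Sa , inj₁ (neighbour-in-N ¬Sa a~v₀ , inNbhdComp G S ¬Sa (_ , refl) a⇝b b~v₁)
      where
      a⇝b : Reach G S a b
      a⇝b = Reach-trans G S (A.centre-reaches i) (subst (λ x → Reach G S x b) (sym e) (B.reaches-centre j))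
    ... | no stars-disjoint = ⊥-elim (≤⇒≯ n≤11 (injective⇒≤ twelve-injective))
      where
      twelve-injective : Injective _≡_ _≡_ (v Vector.++ (A.vertices Vector.++ B.vertices))
      twelve-injective = injective-++ v-injective
        (injective-++ A.vertices-injective B.vertices-injective λ i j e → stars-disjoint (i , j , e))
        λ i j e → ++⁺ (λ x → ¬ S x) A.vertices-outside B.vertices-outside j (i , e)

lemma2p8 : (n : ℕ) → 8 ≤ n → n ≤ 11 → (G : Graph n) → MinDegree≥ G 6 →
    (v : Fin 6 → Fin n) → Injective _≡_ _≡_ v →
    ¬ (v zero ~[ G ] v (suc zero)) →
    Σ (Fin n) λ c → ¬ (∃ λ i → v i ≡ c) ×
      ((InNbhdComp G (λ x → ∃ λ i → v i ≡ x) c (v zero)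
        × InNbhdComp G (λ x → ∃ λ i → v i ≡ x) c (v (suc zero)))
      ⊎ (InNbhdComp G (λ x → ∃ λ i → v i ≡ x) c (v (suc (suc zero)))
        × InNbhdComp G (λ x → ∃ λ i → v i ≡ x) c (v (suc (suc (suc zero))))
        × InNbhdComp G (λ x → ∃ λ i → v i ≡ x) c (v (suc (suc (suc (suc zero)))))
        × InNbhdComp G (λ x → ∃ λ i → v i ≡ x) c (v (suc (suc (suc (suc (suc zero))))))))
lemma2p8 n _ n≤11 G md v v-injective v₀≁v₁
  with outside-neighbour G v md (λ ()) v₀≁v₁
     | outside-neighbour G v md (λ ()) (λ v₁~v₀ → v₀≁v₁ (~-sym G v₁~v₀))
... | a , ¬Sa , v₀~a | b , ¬Sb , v₁~b
  with atMostOne⊎twoDistinct (outside? G v a) a | atMostOne⊎twoDistinct (outside? G v b) b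
... | inj₁ sparse-a | _ = a , sparse⇒conclusion G v md ¬Sa sparse-a
... | inj₂ _ | inj₁ sparse-b = b , sparse⇒conclusion G v md ¬Sb sparse-b
... | inj₂ (a₁ , a₂ , out-a₁ , out-a₂ , a₁≢a₂) | inj₂ (b₁ , b₂ , out-b₁ , out-b₂ , b₁≢b₂) =
  a , dense⇒conclusion G v n≤11 v-injective ¬Sa out-a₁ out-a₂ a₁≢a₂ ¬Sb out-b₁ out-b₂ b₁≢b₂
        (~-sym G v₀~a) (~-sym G v₁~b)
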